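{- Let $\mathcal D$ be an abstract system of proof notations and let $d\in\mathcal D$ be $s$-bounded (in $\mathcal D$). Then, in $\mathrm{Ecl}(\mathcal D)$, the element $\mathsf E d$ is $\|d\|\cdot(s+2)$-bounded and the element $\mathsf E\mathsf E d$ is $2^{\|d\|}\cdot\|d\|\cdot(s+4)$-bounded.
   Context: An abstract system of proof notations is a set $\mathcal D$ together with two functions $|\cdot|,\|\cdot\|\colon\mathcal D\to\mathbb N\setminus\{0\}$ ("size" and "height") and a relation $\to\,\subseteq\mathcal D\times\mathcal D$ such that $d\to d'$ implies $\|d'\|<\|d\|$. Let $\to^\ast$ be the reflexive transitive closure of $\to$. For $d$ in such a system, $\mathcal D\restriction d=\{d'\mid d\to^\ast d'\}$ with the induced structure. A system is $s$-bounded if all its elements have size $\le s$; an element $d$ is $s$-bounded if $\mathcal D\restriction d$ is $s$-bounded. The cut elimination closure $\mathrm{Ecl}(\mathcal D)$ is the abstract system extending $\mathcal D$ defined inductively, with new symbols $\mathsf I,\mathsf R,\mathsf E$: every $d\in\mathcal D$ is in $\mathrm{Ecl}(\mathcal D)$ (with its size and height); if $d,e\in\mathrm{Ecl}(\mathcal D)$ then $\mathsf I d,\ \mathsf R de,\ \mathsf E d\in\mathrm{Ecl}(\mathcal D)$, with $|\mathsf I d|=|d|+1$, $|\mathsf R de|=|d|+|e|+1$, $|\mathsf E d|=|d|+1$, and $\|\mathsf I d\|=\|d\|$, $\|\mathsf R de\|=\|d\|+\|e\|$, $\|\mathsf E d\|=2^{\|d\|}-1$. The relation $\to$ on $\mathrm{Ecl}(\mathcal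 D)$ is inductively generated by: $d\to d'$ whenever this holds in $\mathcal D$; if $d\to d'$ then $\mathsf I d\to\mathsf I d'$ and $\mathsf E d\to\mathsf E d'$; if $e\to e'$ then $\mathsf R de\to\mathsf R de'$; $\mathsf R de\to\mathsf I d$ always; if $d\to d'$ and $d\to d''$ then $\mathsf E d\to\mathsf R(\mathsf E d')(\mathsf E d'')$. -}

module Defs where

open import Data.Nat using (ℕ; zero; suc; _+_; _*_; _∸_; _^_; _≤_; _<_; z≤n; s≤s)
open import Data.Nat.Properties
open import Relation.Binary.Construct.Closure.ReflexiveTransitive using (Star)
open import Relation.Binary.PropositionalEquality using (_≡_; refl; sym; subst)
open import Data.Sum using (inj₁; inj₂)

record AbsSystem : Set₁ where
  field
    Carrier    : Set
    size       : Carrier → ℕ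
    height     : Carrier → ℕ
    size-pos   : ∀ d → 0 < size d
    height-pos : ∀ d → 0 < height d
    _⟶_        : Carrier → Carrier → Set
    decr       : ∀ {d d'} → d ⟶ d' → height d' < height d

  _⟶*_ : Carrier → Carrier → Set
  _⟶*_ = Star _⟶_

  Bounded : ℕ → Carrier → Set
  Bounded s d = ∀ d' → d ⟶* d' → size d' ≤ s

module _ (𝒟 : AbsSystem) where
  private module D = AbsSystem 𝒟

  data EclC : Set where
    inj : D.Carrier → EclC
    I   : EclC → EclC
    R   : EclC → EclC → EclC
    E   : EclC → EclC

  eclSize : EclC → ℕ
  eclSize (inj d) = D.size d
  eclSize (I d)   = suc (eclSize d)
  eclSize (R d e) = eclSize d + eclSize e + 1
  eclSize (E d)   = suc (eclSize d)

  eclHeight : EclC → ℕ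
  eclHeight (inj d) = D.height d
  eclHeight (I d)   = eclHeight d
  eclHeight (R d e) = eclHeight d + eclHeight e
  eclHeight (E d)   = 2 ^ eclHeight d ∸ 1

  data _⟶E_ : EclC → EclC → Set where
    base  : ∀ {d d'} → d D.⟶ d' → inj d ⟶E inj d'
    I-red : ∀ {d d'} → d ⟶E d' → I d ⟶E I d'
    E-red : ∀ {d d'} → d ⟶E d' → E d ⟶E E d'
    R-red : ∀ {d e e'} → e ⟶E e' → R d e ⟶E R d e'
    R-I   : ∀ {d e} → R d e ⟶E I d
    E-R   : ∀ {d d' d''} → d ⟶E d' → d ⟶E d'' → E d ⟶E R (E d') (E d'')

  private
    2^-pos : ∀ n → 1 ≤ 2 ^ n
    2^-pos n = m^n>0 2 n

    2^>1 : ∀ n → 0 < n → 2 ≤ 2 ^ n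
    2^>1 (suc n) _ = *-monoʳ-≤ 2 (2^-pos n)

    2^-double : ∀ a h → a < h → 2 * 2 ^ a ≤ 2 ^ h
    2^-double a (suc h) (s≤s a≤h) = *-monoʳ-≤ 2 (^-monoʳ-≤ 2 a≤h)

    sum-bound : ∀ x y h → 1 ≤ x → 1 ≤ y → x + y ≤ h → (x ∸ 1) + (y ∸ 1) < h ∸ 1
    sum-bound (suc x) (suc y) (suc h) _ _ (s≤s p) =
      subst (_≤ h) (+-suc x y) p

    max2 : ∀ a b h → a < h → b < h → 2 ^ a + 2 ^ b ≤ 2 ^ h
    max2 a b h p q with ≤-total a b
    ... | inj₁ a≤b = ≤-trans (+-monoˡ-≤ (2 ^ b) (^-monoʳ-≤ 2 a≤b))
                       (subst (_≤ 2 ^ h) (cong-double (2 ^ b)) (2^-double b h q))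
      where cong-double : ∀ n → 2 * n ≡ n + n
            cong-double n = cong-aux n
              where cong-aux : ∀ n → 2 * n ≡ n + n
                    cong-aux n rewrite +-identityʳ n = refl
    ... | inj₂ b≤a = ≤-trans (+-monoʳ-≤ (2 ^ a) (^-monoʳ-≤ 2 b≤a))
                       (subst (_≤ 2 ^ h) (cong-aux (2 ^ a)) (2^-double a h p))
      where cong-aux : ∀ n → 2 * n ≡ n + n
            cong-aux n rewrite +-identityʳ n = refl

  eclHeight-pos : ∀ d → 0 < eclHeight d
  eclHeight-pos (inj d) = D.height-pos d
  eclHeight-pos (I d)   = eclHeight-pos d
  eclHeight-pos (R d e) = ≤-trans (eclHeight-pos d) (m≤m+n (eclHeight d) (eclHeight e))
  eclHeight-pos (E d)   = ∸-monoˡ-< (2^>1 (eclHeight d) (eclHeight-pos d)) ≤-refl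

  eclDecr : ∀ {d d'} → d ⟶E d' → eclHeight d' < eclHeight d
  eclDecr (base r)  = D.decr r
  eclDecr (I-red r) = eclDecr r
  eclDecr (E-red {d} {d'} r) =
    ∸-monoˡ-< (^-monoʳ-< 2 (s≤s (s≤s z≤n)) (eclDecr r)) (2^-pos (eclHeight d'))
  eclDecr (R-red {d} r) = +-monoʳ-< (eclHeight d) (eclDecr r)
  eclDecr (R-I {d} {e}) = m<m+n (eclHeight d) (eclHeight-pos e)
  eclDecr (E-R {d} {d'} {d''} r s) =
    sum-bound (2 ^ eclHeight d') (2 ^ eclHeight d'') (2 ^ eclHeight d)
      (2^-pos (eclHeight d')) (2^-pos (eclHeight d'')) (max2 _ _ _ (eclDecr r) (eclDecr s))

  eclSize-pos : ∀ d → 0 < eclSize d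
  eclSize-pos (inj d) = D.size-pos d
  eclSize-pos (I d)   = s≤s z≤n
  eclSize-pos (R d e) = subst (0 <_) (sym (+-comm (eclSize d + eclSize e) 1)) (s≤s z≤n)
  eclSize-pos (E d)   = s≤s z≤n

  Ecl : AbsSystem
  Ecl = record
    { Carrier    = EclC
    ; size       = eclSize
    ; height     = eclHeight
    ; size-pos   = eclSize-pos
    ; height-pos = eclHeight-pos
    ; _⟶_        = _⟶E_
    ; decr       = eclDecr
    }

module Submission where

-- Call a predicate on Ecl(𝒟) a b-sized family if it is closed
-- under one-step reduction and all its members have size ≤ b; every member t
-- of such a family is then b-bounded, since everything reachable from t is
-- again a member.  Given a b-sized family Q and a level k, a "k-chain over Q"
-- is a term of one of the shapes  E u,  R (E u) t,  I t  with Q u, ‖u‖ ≤ k,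
-- and t a chain of level one less (for R and I).  Reducing E u either reduces
-- u (height drops) or yields R (E u') (E u'') with ‖u'‖,‖u''‖ < ‖u‖, so chains
-- are closed under reduction; each layer costs at most b + 2 symbols, so the
-- k-chains form a k·(b+2)-sized family.
-- The theorem applies this construction twice: starting from the atoms inj d'
-- with d' s-bounded, E d is an ‖d‖-chain, giving the first bound; the
-- ‖d‖-chains form a family of which E d is a member of height 2^‖d‖ − 1, so
-- E E d is a (2^‖d‖ − 1)-chain over it, and a final arithmetic estimate turns
-- (2^‖d‖ − 1)·(‖d‖·(s+2) + 2) into 2^‖d‖·‖d‖·(s+4).

open import Defs
open import Data.Nat using (ℕ; zero; suc; _+_; _*_; _^_; _∸_; _≤_; s≤s)
open import Data.Nat.Properties
open import Data.Nat.Tactic.RingSolver using (solve-∀)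
open import Data.Empty using (⊥-elim)
open import Data.Product using (_×_; _,_)
open import Relation.Binary.Construct.Closure.ReflexiveTransitive using (ε; _◅_)
open import Relation.Binary.PropositionalEquality using (_≡_; cong)

module _ (𝒟 : AbsSystem) where
  private module D = AbsSystem 𝒟

  record SizedFamily (b : ℕ) : Set₁ where
    field
      Member : EclC 𝒟 → Set
      closed : ∀ {t t'} → Member t → _⟶E_ 𝒟 t t' → Member t'
      sized  : ∀ {t} → Member t → eclSize 𝒟 t ≤ b

  open SizedFamily public

  member-bounded : ∀ {b} (F : SizedFamily b) {t} → Member F t →
                   AbsSystem.Bounded (Ecl 𝒟) b t
  member-bounded F m t ε        = sized F m
  member-bounded F m t' (r ◅ rs) = member-bounded F (closed F m r) t' rs

  data BoundedAtom (s : ℕ) : EclC 𝒟 → Set where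
    atom : ∀ {d} → D.Bounded s d → BoundedAtom s (inj d)

  boundedAtoms : (s : ℕ) → SizedFamily s
  boundedAtoms s = record
    { Member = BoundedAtom s
    ; closed = λ { (atom bd) (base r) → atom (λ d' rs → bd d' (r ◅ rs)) }
    ; sized  = λ { (atom {d} bd) → bd d ε }
    }

  data Chain (Q : EclC 𝒟 → Set) : ℕ → EclC 𝒟 → Set where
    chainE : ∀ {k u}   → Q u → eclHeight 𝒟 u ≤ k → Chain Q k (E u)
    chainR : ∀ {k u t} → Q u → eclHeight 𝒟 u ≤ k → Chain Q k t → Chain Q (suc k) (R (E u) t)
    chainI : ∀ {k t}   → Chain Q k t → Chain Q (suc k) (I t)

  module _ {b : ℕ} (F : SizedFamily b) where
    private
      Q : EclC 𝒟 → Set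
      Q = Member F

    child-height : ∀ {k u u'} → _⟶E_ 𝒟 u u' → eclHeight 𝒟 u ≤ suc k → eclHeight 𝒟 u' ≤ k
    child-height r hu = ≤-pred (≤-trans (eclDecr 𝒟 r) hu)

    -- One-step reduction preserves being a k-chain.  At level 0 the E-step
    -- E u ⟶ R (E u') (E u'') is impossible: it would need ‖u'‖ < ‖u‖ ≤ 0.
    chain-step : ∀ {k t t'} → Chain Q k t → _⟶E_ 𝒟 t t' → Chain Q k t'
    chain-step (chainE q hu) (E-red r) =
      chainE (closed F q r) (≤-trans (<⇒≤ (eclDecr 𝒟 r)) hu)
    chain-step {zero} (chainE q hu) (E-R r₁ r₂) = ⊥-elim (n≮0 (≤-trans (eclDecr 𝒟 r₁) hu))
    chain-step {suc k} (chainE q hu) (E-R r₁ r₂) =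
      chainR (closed F q r₁) (child-height r₁ hu)
             (chainE (closed F q r₂) (child-height r₂ hu))
    chain-step (chainR q hu c) (R-red r) = chainR q hu (chain-step c r)
    chain-step (chainR q hu c) R-I       = chainI (chainE q hu)
    chain-step (chainI c) (I-red r)      = chainI (chain-step c r)

    -- Each layer E u, R (E u) _, I _ contributes at most b + 2 symbols.
    chain-size : ∀ {k t} → Chain Q k t → eclSize 𝒟 t ≤ k * (b + 2)
    chain-size {zero} (chainE {u = u} q hu) = ⊥-elim (n≮0 (≤-trans (eclHeight-pos 𝒟 u) hu))
    chain-size {suc k} (chainE {u = u} q hu) = begin
      suc (eclSize 𝒟 u)  ≤⟨ s≤s (≤-trans (sized F q) (n≤1+n b)) ⟩
      suc (suc b)        ≡⟨ +-comm 2 b ⟩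
      b + 2              ≤⟨ m≤m+n (b + 2) (k * (b + 2)) ⟩
      suc k * (b + 2)    ∎
      where open ≤-Reasoning
    chain-size {suc k} (chainR {u = u} {t} q hu c) = begin
      suc (eclSize 𝒟 u) + eclSize 𝒟 t + 1 ≡⟨ layer (eclSize 𝒟 u) (eclSize 𝒟 t) ⟩
      (eclSize 𝒟 u + 2) + eclSize 𝒟 t     ≤⟨ +-mono-≤ (+-monoˡ-≤ 2 (sized F q)) (chain-size c) ⟩
      suc k * (b + 2)                       ∎
      where
        open ≤-Reasoning
        layer : ∀ x y → suc x + y + 1 ≡ (x + 2) + y
        layer = solve-∀
    chain-size {suc k} (chainI {t = t} c) = begin
      suc (eclSize 𝒟 t)  ≤⟨ s≤s (chain-size c) ⟩
      suc (k * (b + 2))  ≤⟨ s≤s (m≤n+m (k * (b + 2)) (suc b)) ⟩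
      suc (suc b) + k * (b + 2) ≡⟨ cong (_+ k * (b + 2)) (+-comm 2 b) ⟩
      suc k * (b + 2)    ∎
      where open ≤-Reasoning

    chains : (k : ℕ) → SizedFamily (k * (b + 2))
    chains k = record { Member = Chain Q k ; closed = chain-step ; sized = chain-size }

double-chain-estimate : ∀ h s → 1 ≤ h → (2 ^ h ∸ 1) * (h * (s + 2) + 2) ≤ 2 ^ h * h * (s + 4)
double-chain-estimate h s h≥1 = begin
  (2 ^ h ∸ 1) * (h * (s + 2) + 2)   ≤⟨ *-monoˡ-≤ (h * (s + 2) + 2) (m∸n≤m (2 ^ h) 1) ⟩
  2 ^ h * (h * (s + 2) + 2)         ≤⟨ *-monoʳ-≤ (2 ^ h) (+-monoʳ-≤ (h * (s + 2)) (*-monoˡ-≤ 2 h≥1)) ⟩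
  2 ^ h * (h * (s + 2) + h * 2)     ≡⟨ regroup (2 ^ h) h s ⟩
  2 ^ h * h * (s + 4)               ∎
  where
    open ≤-Reasoning
    regroup : ∀ p h s → p * (h * (s + 2) + h * 2) ≡ p * h * (s + 4)
    regroup = solve-∀

mainTheorem6 : (𝒟 : AbsSystem) (s : ℕ) (d : AbsSystem.Carrier 𝒟) →
    AbsSystem.Bounded 𝒟 s d →
    AbsSystem.Bounded (Ecl 𝒟) (AbsSystem.height 𝒟 d * (s + 2)) (E (inj d))
    × AbsSystem.Bounded (Ecl 𝒟)
        (2 ^ AbsSystem.height 𝒟 d * AbsSystem.height 𝒟 d * (s + 4)) (E (E (inj d)))
mainTheorem6 𝒟 s d bd =
  member-bounded 𝒟 F₁ Ed∈F₁ ,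
  λ t r → ≤-trans (member-bounded 𝒟 F₂ EEd∈F₂ t r)
                  (double-chain-estimate h s (AbsSystem.height-pos 𝒟 d))
  where
    h : ℕ
    h = AbsSystem.height 𝒟 d
    -- F₁: chains of level ‖d‖ over the s-bounded atoms; F₂: chains of level
    -- ‖E d‖ = 2^‖d‖ − 1 over F₁.
    F₁ : SizedFamily 𝒟 (h * (s + 2))
    F₁ = chains 𝒟 (boundedAtoms 𝒟 s) h
    F₂ : SizedFamily 𝒟 ((2 ^ h ∸ 1) * (h * (s + 2) + 2))
    F₂ = chains 𝒟 F₁ (2 ^ h ∸ 1)
    Ed∈F₁ : Member F₁ (E (inj d))
    Ed∈F₁ = chainE (atom bd) ≤-refl
    EEd∈F₂ : Member F₂ (E (E (inj d)))
    EEd∈F₂ = chainE Ed∈F₁ ≤-refl
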